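{- Let $G=(V,E)$ be a finite simple undirected graph and let $W\subseteq V$, $|W|\ge 2$, be a clique of $G$. Let $G\mid W$ denote the clique projection of $W$ and let $F_W=\{x\in STAB(G)\mid x_W=1\}$. Then $$F_W\subseteq STAB(G\mid W)\subseteq STAB(G).$$
   Context: For a graph $H$ on vertex set $V$, $STAB(H)\subseteq\mathbb{R}^V$ is the convex hull of the characteristic vectors of the stable sets of $H$. For $x\in\mathbb{R}^V$ and $W\subseteq V$, $x_W=\sum_{v\in W}x_v$. $N(v)$ denotes the (open) neighborhood of $v$ in $G$. The clique projection of a clique $W$ of $G$ with $|W|\ge 2$ is the graph $G\mid W=(V,E\mid W)$ with $E\mid W=E\cup\{uv\notin E \mid u\neq v,\ W\subseteq N(u)\cup N(v)\}$.
   Formalization: The points $x$ of $STAB(G)$, $F_W$ and $STAB(G\mid W)$ lie in ℚ^V instead of ℝ^V, and the convex-combination weights are rational. -}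

module Defs where

open import Data.Nat using (ℕ; zero; suc)
open import Data.Bool using (Bool; true; false)
open import Data.Fin using (Fin)
import Data.Fin as Fin
open import Data.Fin.Subset using (Subset; Side; inside; outside; _∈_)
open import Data.Vec using (lookup)
open import Data.List using (List; []; _∷_)
open import Data.List.Relation.Unary.All using (All)
open import Data.Product using (Σ; _×_; _,_; proj₁; proj₂)
open import Data.Sum using (_⊎_)
open import Relation.Binary.PropositionalEquality using (_≡_; _≢_)
open import Relation.Nullary using (¬_)
open import Data.Rational using (ℚ; 0ℚ; 1ℚ; _+_; _*_; _≤_)

record Graph (n : ℕ) : Set where
  field
    adj   : Fin n → Fin n → Bool
    sym   : ∀ u v → adj u v ≡ adj v u
    irrefl : ∀ v → adj v v ≡ false

Edge : ∀ {n} → Graph n → Fin n → Fin n → Set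
Edge G u v = Graph.adj G u v ≡ true

IsClique : ∀ {n} → Graph n → Subset n → Set
IsClique G W = ∀ u v → u ∈ W → v ∈ W → u ≢ v → Edge G u v

ProjEdge : ∀ {n} → Graph n → Subset n → Fin n → Fin n → Set
ProjEdge G W u v =
  Edge G u v ⊎ (¬ Edge G u v × u ≢ v × (∀ w → w ∈ W → Edge G u w ⊎ Edge G v w))

IsStable : ∀ {n} → (Fin n → Fin n → Set) → Subset n → Set
IsStable R S = ∀ u v → u ∈ S → v ∈ S → ¬ R u v

side→ℚ : Side → ℚ
side→ℚ inside  = 1ℚ
side→ℚ outside = 0ℚ

χ : ∀ {n} → Subset n → Fin n → ℚ
χ S v = side→ℚ (lookup S v)

sumFin : ∀ {n} → (Fin n → ℚ) → ℚ
sumFin {zero}  f = 0ℚ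
sumFin {suc n} f = f Fin.zero + sumFin (λ i → f (Fin.suc i))

sumOver : ∀ {n} → Subset n → (Fin n → ℚ) → ℚ
sumOver W x = sumFin (λ v → χ W v * x v)

weightSum : ∀ {n} → List (ℚ × Subset n) → ℚ
weightSum [] = 0ℚ
weightSum ((l , _) ∷ cs) = l + weightSum cs

combo : ∀ {n} → List (ℚ × Subset n) → Fin n → ℚ
combo [] v = 0ℚ
combo ((l , S) ∷ cs) v = l * χ S v + combo cs v

STAB : ∀ {n} → (Fin n → Fin n → Set) → (Fin n → ℚ) → Set
STAB {n} R x = Σ (List (ℚ × Subset n)) λ cs →
    All (λ c → 0ℚ ≤ proj₁ c × IsStable R (proj₂ c)) cs
  × weightSum cs ≡ 1ℚ
  × (∀ v → x v ≡ combo cs v)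

{-# OPTIONS --safe #-}
-- Write x = Σ λᵢ χ(Sᵢ) with every Sᵢ stable in G.  A stable set meets the clique W
-- in at most one vertex, so χ(Sᵢ)_W ≤ 1 and x_W ≤ Σ λᵢ = 1; the equality x_W = 1
-- therefore forces χ(Sᵢ)_W = 1, i.e. Sᵢ ∩ W ≠ ∅, whenever λᵢ > 0.  A stable set S
-- containing some w ∈ W stays stable in G|W: a new edge uv of G|W needs w ∈ N(u) ∪ N(v).
-- Dropping the terms of weight zero thus represents x in STAB(G|W).  The other
-- inclusion holds because E ⊆ E|W.
module Submission where

open import Defs
open import Algebra.Bundles using (CommutativeRing)
open import Data.Bool using (_∧_)
open import Data.Nat using (ℕ; _≤_)
open import Data.Fin using (Fin; zero; suc; _≟_)
open import Data.Fin.Properties using (suc-injective; 0≢1+n)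
open import Data.Fin.Subset using (Subset; ∣_∣; inside; outside; _∈_; _∩_; ⊥; Empty)
open import Data.Fin.Subset.Properties using (nonempty?; Empty-unique; x∈p∩q⁻)
open import Data.Vec using ([]; _∷_; lookup; here; there)
open import Data.Vec.Properties using (lookup-zipWith; lookup-replicate)
open import Data.List using (List; []; _∷_)
open import Data.List.Relation.Unary.All as All using (All; []; _∷_)
open import Data.Product using (Σ; _×_; _,_; proj₁; proj₂)
open import Data.Sum using (_⊎_; inj₁; inj₂)
open import Data.Empty using (⊥-elim)
open import Data.Rational using (ℚ; 0ℚ; 1ℚ; _+_; _*_; nonNegative) renaming (_≤_ to _≤ℚ_)
open import Data.Rational.Properties
  using (+-*-commutativeRing; ≤-reflexive; ≤-trans; ≤-antisym; ≮⇒≥; <-irrefl;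
         +-mono-≤; +-mono-<-≤; +-comm; +-identityˡ; *-zeroˡ; *-zeroʳ; *-identityʳ;
         *-monoˡ-≤-nonNeg; nonNegative⁻¹)
open import Data.Rational.Solver using (module +-*-Solver)
open import Function using (_∘_)
open import Relation.Nullary using (yes; no)
open import Relation.Binary.PropositionalEquality
  using (_≡_; refl; sym; trans; cong; cong₂; module ≡-Reasoning)

open import Algebra.Properties.Semiring.Sum (CommutativeRing.semiring +-*-commutativeRing)
  using (sum; sum-cong-≗; ∑-distrib-+; *-distribˡ-sum; sum-replicate-zero)

private
  variable
    n : ℕ

sumFin≡sum : (f : Fin n → ℚ) → sumFin f ≡ sum f
sumFin≡sum {ℕ.zero}  f = refl
sumFin≡sum {ℕ.suc n} f = cong (f zero +_) (sumFin≡sum (f ∘ suc))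

sumOver≡sum : (W : Subset n) (x : Fin n → ℚ) → sumOver W x ≡ sum (λ v → χ W v * x v)
sumOver≡sum W x = sumFin≡sum (λ v → χ W v * x v)

sumOver-cong : (W : Subset n) {x y : Fin n → ℚ} → (∀ v → x v ≡ y v) →
               sumOver W x ≡ sumOver W y
sumOver-cong W {x} {y} x≗y = begin
  sumOver W x                   ≡⟨ sumOver≡sum W x ⟩
  sum (λ v → χ W v * x v)       ≡⟨ sum-cong-≗ (cong (χ W _ *_) ∘ x≗y) ⟩
  sum (λ v → χ W v * y v)       ≡⟨ sumOver≡sum W y ⟨
  sumOver W y                   ∎
  where open ≡-Reasoning

sumOver-linear : (W : Subset n) (l : ℚ) (x y : Fin n → ℚ) →
                 sumOver W (λ v → l * x v + y v) ≡ l * sumOver W x + sumOver W y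
sumOver-linear W l x y = begin
  sumOver W (λ v → l * x v + y v)         ≡⟨ sumOver≡sum W (λ v → l * x v + y v) ⟩
  sum (λ v → χ W v * (l * x v + y v))     ≡⟨ sum-cong-≗ (λ v → distrib (χ W v) (x v) (y v)) ⟩
  sum (λ v → l * Wx v + Wy v)             ≡⟨ ∑-distrib-+ (λ v → l * Wx v) Wy ⟩
  sum (λ v → l * Wx v) + sum Wy           ≡⟨ cong (_+ sum Wy) (*-distribˡ-sum l Wx) ⟨
  l * sum Wx + sum Wy                     ≡⟨ cong₂ (λ a b → l * a + b) (sumOver≡sum W x) (sumOver≡sum W y) ⟨
  l * sumOver W x + sumOver W y           ∎
  where
  open ≡-Reasoning
  open +-*-Solver
  Wx Wy : Fin _ → ℚ
  Wx v = χ W v * x v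
  Wy v = χ W v * y v
  distrib : ∀ w a b → w * (l * a + b) ≡ l * (w * a) + w * b
  distrib = solve 4 (λ l w a b → w :* (l :* a :+ b) := l :* (w :* a) :+ w :* b) refl l

AtMostOne : Subset n → Set
AtMostOne T = ∀ {u v} → u ∈ T → v ∈ T → u ≡ v

side→ℚ-∧ : ∀ s t → side→ℚ (s ∧ t) ≡ side→ℚ s * side→ℚ t
side→ℚ-∧ inside  inside  = refl
side→ℚ-∧ inside  outside = refl
side→ℚ-∧ outside t       = sym (*-zeroˡ (side→ℚ t))

χ-∩ : (S T : Subset n) (v : Fin n) → χ (S ∩ T) v ≡ χ S v * χ T v
χ-∩ S T v = trans (cong side→ℚ (lookup-zipWith _∧_ v S T)) (side→ℚ-∧ (lookup S v) (lookup T v))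

sumOver-χ : (W S : Subset n) → sumOver W (χ S) ≡ sum (χ (W ∩ S))
sumOver-χ W S = trans (sumOver≡sum W (χ S)) (sum-cong-≗ (sym ∘ χ-∩ W S))

sum-χ-empty : (T : Subset n) → Empty T → sum (χ T) ≡ 0ℚ
sum-χ-empty {n} T T-empty = begin
  sum (χ T)           ≡⟨ cong (sum ∘ χ) (Empty-unique T-empty) ⟩
  sum (χ {n} ⊥)       ≡⟨ sum-cong-≗ {n} (λ v → cong side→ℚ (lookup-replicate v outside)) ⟩
  sum {n} (λ _ → 0ℚ)  ≡⟨ sum-replicate-zero n ⟩
  0ℚ                  ∎
  where open ≡-Reasoning

sum-χ-≤1 : (T : Subset n) → AtMostOne T → sum (χ T) ≤ℚ 1ℚ
sum-χ-≤1 []            _      = nonNegative⁻¹ 1ℚ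
sum-χ-≤1 (outside ∷ T) unique =
  ≤-trans (≤-reflexive (+-identityˡ (sum (χ T))))
          (sum-χ-≤1 T λ u∈ v∈ → suc-injective (unique (there u∈) (there v∈)))
sum-χ-≤1 (inside ∷ T)  unique =
  ≤-reflexive (cong (1ℚ +_) (sum-χ-empty T tail-empty))
  where
  tail-empty : Empty T
  tail-empty (v , v∈T) = 0≢1+n (unique here (there v∈T))

clique∩stable-atMostOne : (G : Graph n) {W S : Subset n} → IsClique G W → IsStable (Edge G) S →
                          AtMostOne (W ∩ S)
clique∩stable-atMostOne G {W} {S} clique stable {u} {v} u∈ v∈
  with x∈p∩q⁻ W S u∈ | x∈p∩q⁻ W S v∈ | u ≟ v
... | _         | _         | yes u≡v = u≡v
... | u∈W , u∈S | v∈W , v∈S | no u≢v  = ⊥-elim (stable u v u∈S v∈S (clique u v u∈W v∈W u≢v))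

stable-meeting-W⇒ProjEdge-stable : (G : Graph n) {W S : Subset n} {w : Fin n} → IsStable (Edge G) S →
                                   w ∈ W → w ∈ S → IsStable (ProjEdge G W) S
stable-meeting-W⇒ProjEdge-stable G stable w∈W w∈S u v u∈S v∈S (inj₁ uv) =
  stable u v u∈S v∈S uv
stable-meeting-W⇒ProjEdge-stable G stable w∈W w∈S u v u∈S v∈S (inj₂ (_ , _ , covered))
  with covered _ w∈W
... | inj₁ uw = stable u _ u∈S w∈S uw
... | inj₂ vw = stable v _ v∈S w∈S vw

sumOver-χ-stable≤1 : (G : Graph n) {W S : Subset n} → IsClique G W → IsStable (Edge G) S →
                     sumOver W (χ S) ≤ℚ 1ℚ
sumOver-χ-stable≤1 G {W} {S} clique stable =
  ≤-trans (≤-reflexive (sumOver-χ W S)) (sum-χ-≤1 (W ∩ S) (clique∩stable-atMostOne G clique stable))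

STAB-antimono : ∀ {R R′ : Fin n → Fin n → Set} → (∀ {u v} → R u v → R′ u v) →
                ∀ {x} → STAB R′ x → STAB R x
STAB-antimono R⊆R′ (cs , terms , total , x≗) =
  cs , All.map (λ (0≤l , stable) → 0≤l , λ u v u∈ v∈ → stable u v u∈ v∈ ∘ R⊆R′) terms , total , x≗

weighted : (Subset n → ℚ) → List (ℚ × Subset n) → ℚ
weighted a []             = 0ℚ
weighted a ((l , S) ∷ cs) = l * a S + weighted a cs

sumOver-zero : (W : Subset n) → sumOver W (λ _ → 0ℚ) ≡ 0ℚ
sumOver-zero {n} W =
  trans (sumOver≡sum W (λ _ → 0ℚ)) (trans (sum-cong-≗ (*-zeroʳ ∘ χ W)) (sum-replicate-zero n))

sumOver-combo : (W : Subset n) (cs : List (ℚ × Subset n)) →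
                sumOver W (combo cs) ≡ weighted (sumOver W ∘ χ) cs
sumOver-combo W []             = sumOver-zero W
sumOver-combo W ((l , S) ∷ cs) =
  trans (sumOver-linear W l (χ S) (combo cs)) (cong (l * sumOver W (χ S) +_) (sumOver-combo W cs))

p*q≤p : ∀ {p q} → 0ℚ ≤ℚ p → q ≤ℚ 1ℚ → p * q ≤ℚ p
p*q≤p {p} 0≤p q≤1 = ≤-trans (*-monoˡ-≤-nonNeg p {{nonNegative 0≤p}} q≤1) (≤-reflexive (*-identityʳ p))

+-≤-equality : ∀ {p q r s} → p ≤ℚ q → r ≤ℚ s → p + r ≡ q + s → p ≡ q × r ≡ s
+-≤-equality {p} {q} {r} {s} p≤q r≤s eq =
  left p≤q r≤s eq , left r≤s p≤q (trans (+-comm r p) (trans eq (+-comm q s)))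
  where
  left : ∀ {p q r s} → p ≤ℚ q → r ≤ℚ s → p + r ≡ q + s → p ≡ q
  left p≤q r≤s eq = ≤-antisym p≤q (≮⇒≥ λ p<q → <-irrefl eq (+-mono-<-≤ p<q r≤s))

module _ (a : Subset n → ℚ) where

  Bounded : List (ℚ × Subset n) → Set
  Bounded = All (λ c → 0ℚ ≤ℚ proj₁ c × a (proj₂ c) ≤ℚ 1ℚ)

  weighted≤weightSum : ∀ {cs} → Bounded cs → weighted a cs ≤ℚ weightSum cs
  weighted≤weightSum []                   = ≤-reflexive refl
  weighted≤weightSum ((0≤l , a≤1) ∷ rest) = +-mono-≤ (p*q≤p 0≤l a≤1) (weighted≤weightSum rest)

  weighted≡weightSum⇒tight : ∀ {cs} → Bounded cs → weighted a cs ≡ weightSum cs →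
                             All (λ c → proj₁ c * a (proj₂ c) ≡ proj₁ c) cs
  weighted≡weightSum⇒tight []                   _  = []
  weighted≡weightSum⇒tight ((0≤l , a≤1) ∷ rest) eq =
    let head≡ , rest≡ = +-≤-equality (p*q≤p 0≤l a≤1) (weighted≤weightSum rest) eq
    in head≡ ∷ weighted≡weightSum⇒tight rest rest≡

StableTerms : (Fin n → Fin n → Set) → List (ℚ × Subset n) → Set
StableTerms R = All (λ c → 0ℚ ≤ℚ proj₁ c × IsStable R (proj₂ c))

combo-∷-zero : (S : Subset n) (cs : List (ℚ × Subset n)) (v : Fin n) →
               combo ((0ℚ , S) ∷ cs) v ≡ combo cs v
combo-∷-zero S cs v = trans (cong (_+ combo cs v) (*-zeroˡ (χ S v))) (+-identityˡ (combo cs v))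

dropZeroWeights : ∀ {R : Fin n → Fin n → Set} cs →
                  All (λ c → 0ℚ ≤ℚ proj₁ c × (proj₁ c ≡ 0ℚ ⊎ IsStable R (proj₂ c))) cs →
                  Σ (List (ℚ × Subset n)) λ cs′ →
                    StableTerms R cs′ × weightSum cs′ ≡ weightSum cs × (∀ v → combo cs′ v ≡ combo cs v)
dropZeroWeights []             []                          = [] , [] , refl , λ _ → refl
dropZeroWeights ((l , S) ∷ cs) ((0≤l , inj₂ stable) ∷ rest) =
  let cs′ , terms′ , total , combo≗ = dropZeroWeights cs rest
  in (l , S) ∷ cs′ , (0≤l , stable) ∷ terms′ , cong (l +_) total , λ v → cong (l * χ S v +_) (combo≗ v)
dropZeroWeights ((l , S) ∷ cs) ((_ , inj₁ refl) ∷ rest)     =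
  let cs′ , terms′ , total , combo≗ = dropZeroWeights cs rest
  in cs′ , terms′ , trans total (sym (+-identityˡ (weightSum cs))) ,
     λ v → trans (combo≗ v) (sym (combo-∷-zero S cs v))

face⊆STAB-ProjEdge : (G : Graph n) (W : Subset n) → IsClique G W →
                     ∀ x → STAB (Edge G) x → sumOver W x ≡ 1ℚ → STAB (ProjEdge G W) x
face⊆STAB-ProjEdge {n} G W clique x (cs , terms , total , x≗) xW≡1 =
  let cs′ , terms′ , total′ , combo≗ = dropZeroWeights cs (All.zipWith classify (terms , tight))
  in cs′ , terms′ , trans total′ total , λ v → trans (x≗ v) (sym (combo≗ v))
  where
  open ≡-Reasoning

  a : Subset n → ℚ
  a = sumOver W ∘ χ

  tight : All (λ c → proj₁ c * a (proj₂ c) ≡ proj₁ c) cs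
  tight = weighted≡weightSum⇒tight a
    (All.map (λ (0≤l , stable) → 0≤l , sumOver-χ-stable≤1 G clique stable) terms)
    (begin
      weighted a cs         ≡⟨ sumOver-combo W cs ⟨
      sumOver W (combo cs)  ≡⟨ sumOver-cong W x≗ ⟨
      sumOver W x           ≡⟨ xW≡1 ⟩
      1ℚ                    ≡⟨ total ⟨
      weightSum cs          ∎)

  classify : ∀ {c} → (0ℚ ≤ℚ proj₁ c × IsStable (Edge G) (proj₂ c)) × proj₁ c * a (proj₂ c) ≡ proj₁ c →
             0ℚ ≤ℚ proj₁ c × (proj₁ c ≡ 0ℚ ⊎ IsStable (ProjEdge G W) (proj₂ c))
  classify {l , S} ((0≤l , stable) , l*aS≡l) with nonempty? (W ∩ S)
  ... | yes (w , w∈W∩S) =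
    let w∈W , w∈S = x∈p∩q⁻ W S w∈W∩S
    in 0≤l , inj₂ (stable-meeting-W⇒ProjEdge-stable G stable w∈W w∈S)
  ... | no W∩S-empty = 0≤l , inj₁ (begin
    l          ≡⟨ l*aS≡l ⟨
    l * a S    ≡⟨ cong (l *_) (trans (sumOver-χ W S) (sum-χ-empty (W ∩ S) W∩S-empty)) ⟩
    l * 0ℚ     ≡⟨ *-zeroʳ l ⟩
    0ℚ         ∎)

lemma1 : ∀ {n : ℕ} (G : Graph n) (W : Subset n) →
    IsClique G W → 2 ≤ ∣ W ∣ →
    (∀ (x : Fin n → ℚ) → STAB (Edge G) x → sumOver W x ≡ 1ℚ →
    STAB (ProjEdge G W) x)
    × (∀ (x : Fin n → ℚ) → STAB (ProjEdge G W) x → STAB (Edge G) x)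
-- 2 ≤ ∣ W ∣ only serves to make G|W a clique projection in the paper; the
-- inclusions hold for every clique W.
lemma1 G W clique _ = face⊆STAB-ProjEdge G W clique , λ _ → STAB-antimono inj₁
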